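{- Let $\mathcal{A},\mathcal{B}$ be inquisitive algebras (or both dependence algebras) and $\phi$ a formula. (i) If $\mathcal{A}\vDash^c\phi$ and $\mathcal{B}$ is a subalgebra of $\mathcal{A}$, then $\mathcal{B}\vDash^c\phi$. (ii) If $\mathcal{A}\vDash^c\phi$, $\mathcal{A}$ is a subalgebra of $\mathcal{B}$ and $\mathcal{A}_c=\mathcal{B}_c$, then $\mathcal{B}\vDash^c\phi$.
   Context: Formulas are built from a countable set $\mathtt{At}$ of variables by $\bot,\land,\lor,\to$ (and $\otimes$ in the dependence case). A Brouwerian semilattice is $(B,\land,\to,0)$ with $(B,\land)$ a meet-semilattice with least element $0$ and $a\land b\le c\iff a\le b\to c$. An inquisitive algebra is a first-order structure $\mathcal{A}=(A,A_c,\land,\lor,\to,0)$ with a unary predicate $A_c\subseteq A$ (the core, also written $\mathcal{A}_c$) such that, with $\langle A_c\rangle$ the closure of $A_c$ under $\land,\lor,\to,0$, $(\langle A_c\rangle,\lor,\land,\to,0)$ is a Heyting algebra; $(A_c,\land,\to,0)$ is a Brouwerian semilattice; and $a\to(x\lor y)=(a\to x)\lor(a\to y)$ for all $a\in A_c$, $x,y\in\langle A_c\rangle$. A dependence algebra is $(A,A_c,\land,\otimes,\lor,\to,0)$ with $A_c\subseteq A$ such that, with $\langle A_c\rangle$ the closure under $\lor,\otimes,\land,\to,0$, $(\langle A_c\rangle,\lor,\land,\to,0)$ is a Heyting algebra; $(A_c,\otimes,\land,\to,0)$ is a Heyting algebra; and for $a\in A_c$, $x,y,z,k\in\langle A_c\rangle$: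 $a\to(x\lor y)=(a\to x)\lor(a\to y)$, $x\otimes(y\lor z)=(x\otimes y)\lor(x\otimes z)$, $(x\to z)\to(y\to k)=(x\otimes y)\to(z\otimes k)$. $\mathcal{B}$ is a subalgebra of $\mathcal{A}$ if it is a substructure in the model-theoretic sense: $B\subseteq A$, $B$ closed under the operations of $\mathcal{A}$, and $B_c=A_c\cap B$. $1:=0\to0$. A core valuation is $\mu:\mathtt{At}\to A_c$, extended homomorphically to formulas; $\mathcal{A}\vDash^c\phi$ means $\phi$ evaluates to $1$ under every core valuation. -}

module Defs where

open import Level using (Level; _⊔_; suc)
open import Data.Nat using (ℕ)
open import Data.Product using (Σ; _×_)
open import Function.Bundles using (_⇔_)
open import Relation.Binary.PropositionalEquality using (_≡_)
open import Function.Definitions using (Injective)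

Op₂ : ∀ {c} → Set c → Set c
Op₂ A = A → A → A

At : Set
At = ℕ

data IForm : Set where
  var  : At → IForm
  ⊥f   : IForm
  _∧f_ _∨f_ _→f_ : IForm → IForm → IForm

data DForm : Set where
  var  : At → DForm
  ⊥f   : DForm
  _∧f_ _∨f_ _→f_ _⊗f_ : DForm → DForm → DForm

module _ {c ℓ : Level} {A : Set c} where

  record IsHeytingOn (P : A → Set ℓ) (_∨_ _∧_ _⇒_ : Op₂ A) (𝟘 : A) : Set (c ⊔ ℓ) where
    field
      ∨-closed : ∀ {x y} → P x → P y → P (x ∨ y)
      ∧-closed : ∀ {x y} → P x → P y → P (x ∧ y)
      ⇒-closed : ∀ {x y} → P x → P y → P (x ⇒ y)
      𝟘-closed : P 𝟘
      ∨-assoc : ∀ {x y z} → P x → P y → P z → (x ∨ y) ∨ z ≡ x ∨ (y ∨ z)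
      ∨-comm  : ∀ {x y} → P x → P y → x ∨ y ≡ y ∨ x
      ∧-assoc : ∀ {x y z} → P x → P y → P z → (x ∧ y) ∧ z ≡ x ∧ (y ∧ z)
      ∧-comm  : ∀ {x y} → P x → P y → x ∧ y ≡ y ∧ x
      ∨-absorbs-∧ : ∀ {x y} → P x → P y → x ∨ (x ∧ y) ≡ x
      ∧-absorbs-∨ : ∀ {x y} → P x → P y → x ∧ (x ∨ y) ≡ x
      𝟘-least : ∀ {x} → P x → 𝟘 ∧ x ≡ 𝟘
      residuation : ∀ {x y z} → P x → P y → P z →
                    (((x ∧ y) ∧ z) ≡ (x ∧ y)) ⇔ ((x ∧ (y ⇒ z)) ≡ x)

  record IsBrouwerianOn (P : A → Set ℓ) (_∧_ _⇒_ : Op₂ A) (𝟘 : A) : Set (c ⊔ ℓ) where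
    field
      ∧-closed : ∀ {x y} → P x → P y → P (x ∧ y)
      ⇒-closed : ∀ {x y} → P x → P y → P (x ⇒ y)
      𝟘-closed : P 𝟘
      ∧-assoc : ∀ {x y z} → P x → P y → P z → (x ∧ y) ∧ z ≡ x ∧ (y ∧ z)
      ∧-comm  : ∀ {x y} → P x → P y → x ∧ y ≡ y ∧ x
      ∧-idem  : ∀ {x} → P x → x ∧ x ≡ x
      𝟘-least : ∀ {x} → P x → 𝟘 ∧ x ≡ 𝟘
      residuation : ∀ {x y z} → P x → P y → P z →
                    (((x ∧ y) ∧ z) ≡ (x ∧ y)) ⇔ ((x ∧ (y ⇒ z)) ≡ x)

data Gen {c ℓ} {A : Set c} (C : A → Set ℓ) (_∧_ _∨_ _⇒_ : Op₂ A) (𝟘 : A) : A → Set (c ⊔ ℓ) where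
  base : ∀ {x} → C x → Gen C _∧_ _∨_ _⇒_ 𝟘 x
  g𝟘   : Gen C _∧_ _∨_ _⇒_ 𝟘 𝟘
  g∧   : ∀ {x y} → Gen C _∧_ _∨_ _⇒_ 𝟘 x → Gen C _∧_ _∨_ _⇒_ 𝟘 y → Gen C _∧_ _∨_ _⇒_ 𝟘 (x ∧ y)
  g∨   : ∀ {x y} → Gen C _∧_ _∨_ _⇒_ 𝟘 x → Gen C _∧_ _∨_ _⇒_ 𝟘 y → Gen C _∧_ _∨_ _⇒_ 𝟘 (x ∨ y)
  g⇒   : ∀ {x y} → Gen C _∧_ _∨_ _⇒_ 𝟘 x → Gen C _∧_ _∨_ _⇒_ 𝟘 y → Gen C _∧_ _∨_ _⇒_ 𝟘 (x ⇒ y)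

data Gen⊗ {c ℓ} {A : Set c} (C : A → Set ℓ) (_∧_ _∨_ _⊗_ _⇒_ : Op₂ A) (𝟘 : A) : A → Set (c ⊔ ℓ) where
  base : ∀ {x} → C x → Gen⊗ C _∧_ _∨_ _⊗_ _⇒_ 𝟘 x
  g𝟘   : Gen⊗ C _∧_ _∨_ _⊗_ _⇒_ 𝟘 𝟘
  g∧   : ∀ {x y} → Gen⊗ C _∧_ _∨_ _⊗_ _⇒_ 𝟘 x → Gen⊗ C _∧_ _∨_ _⊗_ _⇒_ 𝟘 y → Gen⊗ C _∧_ _∨_ _⊗_ _⇒_ 𝟘 (x ∧ y)
  g∨   : ∀ {x y} → Gen⊗ C _∧_ _∨_ _⊗_ _⇒_ 𝟘 x → Gen⊗ C _∧_ _∨_ _⊗_ _⇒_ 𝟘 y → Gen⊗ C _∧_ _∨_ _⊗_ _⇒_ 𝟘 (x ∨ y)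
  g⊗   : ∀ {x y} → Gen⊗ C _∧_ _∨_ _⊗_ _⇒_ 𝟘 x → Gen⊗ C _∧_ _∨_ _⊗_ _⇒_ 𝟘 y → Gen⊗ C _∧_ _∨_ _⊗_ _⇒_ 𝟘 (x ⊗ y)
  g⇒   : ∀ {x y} → Gen⊗ C _∧_ _∨_ _⊗_ _⇒_ 𝟘 x → Gen⊗ C _∧_ _∨_ _⊗_ _⇒_ 𝟘 y → Gen⊗ C _∧_ _∨_ _⊗_ _⇒_ 𝟘 (x ⇒ y)

record InqAlgebra (c ℓ : Level) : Set (suc (c ⊔ ℓ)) where
  field
    Carrier : Set c
    Core    : Carrier → Set ℓ
    _∧_ _∨_ _⇒_ : Op₂ Carrier
    𝟘 : Carrier

  ⟨Core⟩ : Carrier → Set (c ⊔ ℓ)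
  ⟨Core⟩ = Gen Core _∧_ _∨_ _⇒_ 𝟘

  field
    heyting     : IsHeytingOn ⟨Core⟩ _∨_ _∧_ _⇒_ 𝟘
    brouwerian  : IsBrouwerianOn Core _∧_ _⇒_ 𝟘
    split       : ∀ {a x y} → Core a → ⟨Core⟩ x → ⟨Core⟩ y →
                  (a ⇒ (x ∨ y)) ≡ ((a ⇒ x) ∨ (a ⇒ y))

  𝟙 : Carrier
  𝟙 = 𝟘 ⇒ 𝟘

record DepAlgebra (c ℓ : Level) : Set (suc (c ⊔ ℓ)) where
  field
    Carrier : Set c
    Core    : Carrier → Set ℓ
    _∧_ _⊗_ _∨_ _⇒_ : Op₂ Carrier
    𝟘 : Carrier

  ⟨Core⟩ : Carrier → Set (c ⊔ ℓ)
  ⟨Core⟩ = Gen⊗ Core _∧_ _∨_ _⊗_ _⇒_ 𝟘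

  field
    heyting     : IsHeytingOn ⟨Core⟩ _∨_ _∧_ _⇒_ 𝟘
    coreHeyting : IsHeytingOn Core _⊗_ _∧_ _⇒_ 𝟘
    split       : ∀ {a x y} → Core a → ⟨Core⟩ x → ⟨Core⟩ y →
                  (a ⇒ (x ∨ y)) ≡ ((a ⇒ x) ∨ (a ⇒ y))
    ⊗-distrib-∨ : ∀ {x y z} → ⟨Core⟩ x → ⟨Core⟩ y → ⟨Core⟩ z →
                  (x ⊗ (y ∨ z)) ≡ ((x ⊗ y) ∨ (x ⊗ z))
    ⇒-⊗-law     : ∀ {x y z k} → ⟨Core⟩ x → ⟨Core⟩ y → ⟨Core⟩ z → ⟨Core⟩ k →
                  ((x ⇒ z) ⇒ (y ⇒ k)) ≡ ((x ⊗ y) ⇒ (z ⊗ k))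

  𝟙 : Carrier
  𝟙 = 𝟘 ⇒ 𝟘

module _ {c ℓ} (𝓐 : InqAlgebra c ℓ) where
  open InqAlgebra 𝓐

  ⟦_⟧ᵢ : IForm → (At → Carrier) → Carrier
  ⟦ var p ⟧ᵢ   μ = μ p
  ⟦ ⊥f ⟧ᵢ      μ = 𝟘
  ⟦ φ ∧f ψ ⟧ᵢ  μ = _∧_ (⟦ φ ⟧ᵢ μ) (⟦ ψ ⟧ᵢ μ)
  ⟦ φ ∨f ψ ⟧ᵢ  μ = ⟦ φ ⟧ᵢ μ ∨ ⟦ ψ ⟧ᵢ μ
  ⟦ φ →f ψ ⟧ᵢ  μ = ⟦ φ ⟧ᵢ μ ⇒ ⟦ ψ ⟧ᵢ μ

  _⊨ᶜᵢ_ : IForm → Set (c ⊔ ℓ)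
  _⊨ᶜᵢ_ φ = (μ : At → Carrier) → (∀ p → Core (μ p)) → ⟦ φ ⟧ᵢ μ ≡ 𝟙

module _ {c ℓ} (𝓐 : DepAlgebra c ℓ) where
  open DepAlgebra 𝓐

  ⟦_⟧ₔ : DForm → (At → Carrier) → Carrier
  ⟦ var p ⟧ₔ   μ = μ p
  ⟦ ⊥f ⟧ₔ      μ = 𝟘
  ⟦ φ ∧f ψ ⟧ₔ  μ = ⟦ φ ⟧ₔ μ ∧ ⟦ ψ ⟧ₔ μ
  ⟦ φ ∨f ψ ⟧ₔ  μ = ⟦ φ ⟧ₔ μ ∨ ⟦ ψ ⟧ₔ μ
  ⟦ φ →f ψ ⟧ₔ  μ = ⟦ φ ⟧ₔ μ ⇒ ⟦ ψ ⟧ₔ μ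
  ⟦ φ ⊗f ψ ⟧ₔ  μ = ⟦ φ ⟧ₔ μ ⊗ ⟦ ψ ⟧ₔ μ

  _⊨ᶜₔ_ : DForm → Set (c ⊔ ℓ)
  _⊨ᶜₔ_ φ = (μ : At → Carrier) → (∀ p → Core (μ p)) → ⟦ φ ⟧ₔ μ ≡ 𝟙

-- Subalgebras (substructures), rendered as embeddings ι : B ↪ A:
-- ι injective, preserves all operations and 0, and B_c = A_c ∩ B, i.e.
-- Core_B b ⇔ Core_A (ι b).

record InqSubalgebra {c₁ ℓ₁ c₂ ℓ₂} (𝓑 : InqAlgebra c₁ ℓ₁) (𝓐 : InqAlgebra c₂ ℓ₂)
       : Set (c₁ ⊔ ℓ₁ ⊔ c₂ ⊔ ℓ₂) where
  private
    module B = InqAlgebra 𝓑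
    module A = InqAlgebra 𝓐
  field
    ι      : B.Carrier → A.Carrier
    ι-inj  : Injective _≡_ _≡_ ι
    ι-∧    : ∀ x y → ι (x B.∧ y) ≡ (ι x A.∧ ι y)
    ι-∨    : ∀ x y → ι (x B.∨ y) ≡ (ι x A.∨ ι y)
    ι-⇒    : ∀ x y → ι (x B.⇒ y) ≡ (ι x A.⇒ ι y)
    ι-𝟘    : ι B.𝟘 ≡ A.𝟘
    ι-core : ∀ x → B.Core x ⇔ A.Core (ι x)

record DepSubalgebra {c₁ ℓ₁ c₂ ℓ₂} (𝓑 : DepAlgebra c₁ ℓ₁) (𝓐 : DepAlgebra c₂ ℓ₂)
       : Set (c₁ ⊔ ℓ₁ ⊔ c₂ ⊔ ℓ₂) where
  private
    module B = DepAlgebra 𝓑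
    module A = DepAlgebra 𝓐
  field
    ι      : B.Carrier → A.Carrier
    ι-inj  : Injective _≡_ _≡_ ι
    ι-∧    : ∀ x y → ι (x B.∧ y) ≡ (ι x A.∧ ι y)
    ι-⊗    : ∀ x y → ι (x B.⊗ y) ≡ (ι x A.⊗ ι y)
    ι-∨    : ∀ x y → ι (x B.∨ y) ≡ (ι x A.∨ ι y)
    ι-⇒    : ∀ x y → ι (x B.⇒ y) ≡ (ι x A.⇒ ι y)
    ι-𝟘    : ι B.𝟘 ≡ A.𝟘
    ι-core : ∀ x → B.Core x ⇔ A.Core (ι x)

-- For an embedding 𝓐 ↪ 𝓑, "𝓐_c = 𝓑_c": every core element of 𝓑 lies in
-- (the image of) 𝓐 (the inclusion 𝓐_c ⊆ 𝓑_c is already part of the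
-- subalgebra condition).
SameCoreᵢ : ∀ {c₁ ℓ₁ c₂ ℓ₂} {𝓐 : InqAlgebra c₁ ℓ₁} {𝓑 : InqAlgebra c₂ ℓ₂} →
            InqSubalgebra 𝓐 𝓑 → Set (c₁ ⊔ c₂ ⊔ ℓ₂)
SameCoreᵢ {𝓐 = 𝓐} {𝓑} S =
  ∀ b → InqAlgebra.Core 𝓑 b → Σ (InqAlgebra.Carrier 𝓐) (λ a → InqSubalgebra.ι S a ≡ b)

SameCoreₔ : ∀ {c₁ ℓ₁ c₂ ℓ₂} {𝓐 : DepAlgebra c₁ ℓ₁} {𝓑 : DepAlgebra c₂ ℓ₂} →
            DepSubalgebra 𝓐 𝓑 → Set (c₁ ⊔ c₂ ⊔ ℓ₂)
SameCoreₔ {𝓐 = 𝓐} {𝓑} S =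
  ∀ b → DepAlgebra.Core 𝓑 b → Σ (DepAlgebra.Carrier 𝓐) (λ a → DepSubalgebra.ι S a ≡ b)

-- Core validity is a universal statement over core valuations, and an
-- embedding commutes with the evaluation of formulas.  Going down, a core
-- valuation of the subalgebra is, after the embedding, a core valuation of the
-- ambient algebra, and injectivity reflects ⟦ φ ⟧ = 1.  Going up, when the two
-- cores coincide every core valuation of the ambient algebra factors through
-- the subalgebra, so the value of φ is the image of a value that is already 1.
module Submission where

open import Defs
open import Level using (Level)
open import Data.Product using (_×_; _,_; proj₁; proj₂)
open import Function.Base using (_∘_)
open import Function.Bundles using (Equivalence)
open import Relation.Binary.PropositionalEquality
  using (_≡_; refl; sym; trans; cong; cong₂; subst; module ≡-Reasoning)

open Equivalence using (to; from)

module _ {c ℓ} (𝓐 : InqAlgebra c ℓ) where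
  open InqAlgebra 𝓐

  ⟦⟧ᵢ-cong : ∀ φ {μ ν : At → Carrier} → (∀ p → μ p ≡ ν p) → ⟦_⟧ᵢ 𝓐 φ μ ≡ ⟦_⟧ᵢ 𝓐 φ ν
  ⟦⟧ᵢ-cong (var p)  μ≗ν = μ≗ν p
  ⟦⟧ᵢ-cong ⊥f       μ≗ν = refl
  ⟦⟧ᵢ-cong (φ ∧f ψ) μ≗ν = cong₂ _∧_ (⟦⟧ᵢ-cong φ μ≗ν) (⟦⟧ᵢ-cong ψ μ≗ν)
  ⟦⟧ᵢ-cong (φ ∨f ψ) μ≗ν = cong₂ _∨_ (⟦⟧ᵢ-cong φ μ≗ν) (⟦⟧ᵢ-cong ψ μ≗ν)
  ⟦⟧ᵢ-cong (φ →f ψ) μ≗ν = cong₂ _⇒_ (⟦⟧ᵢ-cong φ μ≗ν) (⟦⟧ᵢ-cong ψ μ≗ν)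

module _ {c ℓ} (𝓐 : DepAlgebra c ℓ) where
  open DepAlgebra 𝓐

  ⟦⟧ₔ-cong : ∀ φ {μ ν : At → Carrier} → (∀ p → μ p ≡ ν p) → ⟦_⟧ₔ 𝓐 φ μ ≡ ⟦_⟧ₔ 𝓐 φ ν
  ⟦⟧ₔ-cong (var p)  μ≗ν = μ≗ν p
  ⟦⟧ₔ-cong ⊥f       μ≗ν = refl
  ⟦⟧ₔ-cong (φ ∧f ψ) μ≗ν = cong₂ _∧_ (⟦⟧ₔ-cong φ μ≗ν) (⟦⟧ₔ-cong ψ μ≗ν)
  ⟦⟧ₔ-cong (φ ∨f ψ) μ≗ν = cong₂ _∨_ (⟦⟧ₔ-cong φ μ≗ν) (⟦⟧ₔ-cong ψ μ≗ν)
  ⟦⟧ₔ-cong (φ →f ψ) μ≗ν = cong₂ _⇒_ (⟦⟧ₔ-cong φ μ≗ν) (⟦⟧ₔ-cong ψ μ≗ν)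
  ⟦⟧ₔ-cong (φ ⊗f ψ) μ≗ν = cong₂ _⊗_ (⟦⟧ₔ-cong φ μ≗ν) (⟦⟧ₔ-cong ψ μ≗ν)

module InqSubalgebraProperties {c₁ ℓ₁ c₂ ℓ₂} {𝓑 : InqAlgebra c₁ ℓ₁} {𝓐 : InqAlgebra c₂ ℓ₂}
                               (S : InqSubalgebra 𝓑 𝓐) where
  open InqSubalgebra S
  private
    module B = InqAlgebra 𝓑
    module A = InqAlgebra 𝓐

  ι-⟦⟧ : ∀ φ ν → ι (⟦_⟧ᵢ 𝓑 φ ν) ≡ ⟦_⟧ᵢ 𝓐 φ (ι ∘ ν)
  ι-⟦⟧ (var p)  ν = refl
  ι-⟦⟧ ⊥f       ν = ι-𝟘
  ι-⟦⟧ (φ ∧f ψ) ν = trans (ι-∧ _ _) (cong₂ A._∧_ (ι-⟦⟧ φ ν) (ι-⟦⟧ ψ ν))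
  ι-⟦⟧ (φ ∨f ψ) ν = trans (ι-∨ _ _) (cong₂ A._∨_ (ι-⟦⟧ φ ν) (ι-⟦⟧ ψ ν))
  ι-⟦⟧ (φ →f ψ) ν = trans (ι-⇒ _ _) (cong₂ A._⇒_ (ι-⟦⟧ φ ν) (ι-⟦⟧ ψ ν))

  ι-𝟙 : ι B.𝟙 ≡ A.𝟙
  ι-𝟙 = trans (ι-⇒ _ _) (cong₂ A._⇒_ ι-𝟘 ι-𝟘)

  ⊨ᶜ-restrict : ∀ φ → 𝓐 ⊨ᶜᵢ φ → 𝓑 ⊨ᶜᵢ φ
  ⊨ᶜ-restrict φ ⊨φ ν ν-core = ι-inj (begin
    ι (⟦_⟧ᵢ 𝓑 φ ν)      ≡⟨ ι-⟦⟧ φ ν ⟩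
    ⟦_⟧ᵢ 𝓐 φ (ι ∘ ν)    ≡⟨ ⊨φ (ι ∘ ν) (λ p → to (ι-core (ν p)) (ν-core p)) ⟩
    A.𝟙                 ≡⟨ sym ι-𝟙 ⟩
    ι B.𝟙               ∎)
    where open ≡-Reasoning

  ⊨ᶜ-extend : SameCoreᵢ S → ∀ φ → 𝓑 ⊨ᶜᵢ φ → 𝓐 ⊨ᶜᵢ φ
  ⊨ᶜ-extend sameCore φ ⊨φ μ μ-core = begin
    ⟦_⟧ᵢ 𝓐 φ μ          ≡⟨ ⟦⟧ᵢ-cong 𝓐 φ (λ p → sym (ι∘ν≗μ p)) ⟩
    ⟦_⟧ᵢ 𝓐 φ (ι ∘ ν)    ≡⟨ sym (ι-⟦⟧ φ ν) ⟩
    ι (⟦_⟧ᵢ 𝓑 φ ν)      ≡⟨ cong ι (⊨φ ν ν-core) ⟩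
    ι B.𝟙               ≡⟨ ι-𝟙 ⟩
    A.𝟙                 ∎
    where
    open ≡-Reasoning
    ν : At → B.Carrier
    ν p = proj₁ (sameCore (μ p) (μ-core p))
    ι∘ν≗μ : ∀ p → ι (ν p) ≡ μ p
    ι∘ν≗μ p = proj₂ (sameCore (μ p) (μ-core p))
    ν-core : ∀ p → B.Core (ν p)
    ν-core p = from (ι-core (ν p)) (subst A.Core (sym (ι∘ν≗μ p)) (μ-core p))

module DepSubalgebraProperties {c₁ ℓ₁ c₂ ℓ₂} {𝓑 : DepAlgebra c₁ ℓ₁} {𝓐 : DepAlgebra c₂ ℓ₂}
                               (S : DepSubalgebra 𝓑 𝓐) where
  open DepSubalgebra S
  private
    module B = DepAlgebra 𝓑
    module A = DepAlgebra 𝓐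

  ι-⟦⟧ : ∀ φ ν → ι (⟦_⟧ₔ 𝓑 φ ν) ≡ ⟦_⟧ₔ 𝓐 φ (ι ∘ ν)
  ι-⟦⟧ (var p)  ν = refl
  ι-⟦⟧ ⊥f       ν = ι-𝟘
  ι-⟦⟧ (φ ∧f ψ) ν = trans (ι-∧ _ _) (cong₂ A._∧_ (ι-⟦⟧ φ ν) (ι-⟦⟧ ψ ν))
  ι-⟦⟧ (φ ∨f ψ) ν = trans (ι-∨ _ _) (cong₂ A._∨_ (ι-⟦⟧ φ ν) (ι-⟦⟧ ψ ν))
  ι-⟦⟧ (φ →f ψ) ν = trans (ι-⇒ _ _) (cong₂ A._⇒_ (ι-⟦⟧ φ ν) (ι-⟦⟧ ψ ν))
  ι-⟦⟧ (φ ⊗f ψ) ν = trans (ι-⊗ _ _) (cong₂ A._⊗_ (ι-⟦⟧ φ ν) (ι-⟦⟧ ψ ν))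

  ι-𝟙 : ι B.𝟙 ≡ A.𝟙
  ι-𝟙 = trans (ι-⇒ _ _) (cong₂ A._⇒_ ι-𝟘 ι-𝟘)

  ⊨ᶜ-restrict : ∀ φ → 𝓐 ⊨ᶜₔ φ → 𝓑 ⊨ᶜₔ φ
  ⊨ᶜ-restrict φ ⊨φ ν ν-core = ι-inj (begin
    ι (⟦_⟧ₔ 𝓑 φ ν)      ≡⟨ ι-⟦⟧ φ ν ⟩
    ⟦_⟧ₔ 𝓐 φ (ι ∘ ν)    ≡⟨ ⊨φ (ι ∘ ν) (λ p → to (ι-core (ν p)) (ν-core p)) ⟩
    A.𝟙                 ≡⟨ sym ι-𝟙 ⟩
    ι B.𝟙               ∎)
    where open ≡-Reasoning

  ⊨ᶜ-extend : SameCoreₔ S → ∀ φ → 𝓑 ⊨ᶜₔ φ → 𝓐 ⊨ᶜₔ φ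
  ⊨ᶜ-extend sameCore φ ⊨φ μ μ-core = begin
    ⟦_⟧ₔ 𝓐 φ μ          ≡⟨ ⟦⟧ₔ-cong 𝓐 φ (λ p → sym (ι∘ν≗μ p)) ⟩
    ⟦_⟧ₔ 𝓐 φ (ι ∘ ν)    ≡⟨ sym (ι-⟦⟧ φ ν) ⟩
    ι (⟦_⟧ₔ 𝓑 φ ν)      ≡⟨ cong ι (⊨φ ν ν-core) ⟩
    ι B.𝟙               ≡⟨ ι-𝟙 ⟩
    A.𝟙                 ∎
    where
    open ≡-Reasoning
    ν : At → B.Carrier
    ν p = proj₁ (sameCore (μ p) (μ-core p))
    ι∘ν≗μ : ∀ p → ι (ν p) ≡ μ p
    ι∘ν≗μ p = proj₂ (sameCore (μ p) (μ-core p))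
    ν-core : ∀ p → B.Core (ν p)
    ν-core p = from (ι-core (ν p)) (subst A.Core (sym (ι∘ν≗μ p)) (μ-core p))

proposition2p9 :
    ∀ {c₁ ℓ₁ c₂ ℓ₂ : Level} →
    ((𝓐 : InqAlgebra c₁ ℓ₁) (𝓑 : InqAlgebra c₂ ℓ₂) (φ : IForm) →
       ((_⊨ᶜᵢ_ 𝓐 φ → InqSubalgebra 𝓑 𝓐 → _⊨ᶜᵢ_ 𝓑 φ)
        × ((S : InqSubalgebra 𝓐 𝓑) → _⊨ᶜᵢ_ 𝓐 φ → SameCoreᵢ S → _⊨ᶜᵢ_ 𝓑 φ)))
    × ((𝓐 : DepAlgebra c₁ ℓ₁) (𝓑 : DepAlgebra c₂ ℓ₂) (φ : DForm) →
       ((_⊨ᶜₔ_ 𝓐 φ → DepSubalgebra 𝓑 𝓐 → _⊨ᶜₔ_ 𝓑 φ)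
        × ((S : DepSubalgebra 𝓐 𝓑) → _⊨ᶜₔ_ 𝓐 φ → SameCoreₔ S → _⊨ᶜₔ_ 𝓑 φ)))
proposition2p9 =
    (λ _ _ φ → (λ ⊨φ S → InqSubalgebraProperties.⊨ᶜ-restrict S φ ⊨φ)
             , (λ S ⊨φ sameCore → InqSubalgebraProperties.⊨ᶜ-extend S sameCore φ ⊨φ))
  , (λ _ _ φ → (λ ⊨φ S → DepSubalgebraProperties.⊨ᶜ-restrict S φ ⊨φ)
             , (λ S ⊨φ sameCore → DepSubalgebraProperties.⊨ᶜ-extend S sameCore φ ⊨φ))
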